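{- Let $\mathcal A$ be a cyclic $c$-noncrossing arc diagram such that $\mathcal C^n(\mathcal A)$ is infinite, and let $\tau^n$ be a periodic factor of this sequence. For every chain or loop $\gamma$ of $\mathcal A$, if $\mathrm{Supp}(\gamma)\cap\overline{L_c}\ne\emptyset$ and $\mathrm{Supp}(\gamma)\cap\overline{R_c}\ne\emptyset$, then some element of $\mathrm{Supp}(\gamma)$ has its residue modulo $n$ occurring in $\tau^n$.
   Context: $c$ is a Coxeter element of $\widehat{\mathfrak S}_n$ (product, once each, of simple generators $s_i$ exchanging $i+mn,i+1+mn$), moving every integer; $\overline{L_c}=\{x:c(x)>x\}$, $\overline{R_c}=\{x:c(x)<x\}$. An arc is $(p,q,L,R)$, $p<q$, $p\not\equiv q\pmod n$, $L\sqcup R=\{p+1,\dots,q-1\}$; distinct arcs $(p,q,L,R),(p',q',L',R')$ cross iff $((L\cup\{p,q\})\cap R')\cup(L\cap\{p',q'\})\ne\emptyset$ and $(R\cap(L'\cup\{p',q'\}))\cup(\{p,q\}\cap L')\ne\emptyset$. A cyclic $c$-noncrossing arc diagram $\mathcal A$ is an $n$-translation-invariant set of pairwise noncrossing arcs, no two sharing an initial point or a final point, each with $L\subseteq\overline{L_c}$, $R\subseteq\overline{R_c}$ (arcs written $p\to q$), all of whose loops are real. Partial chain: finite sequence of arcs, final point of each equal to initial point of the next; full chain: non-extendable partial chain; loop: bi-infinite such sequence, real if its endpoints meet both $\overline{L_c}$ and $\overline{R_c}$; chain: full chain or singleton $\{x\}$ for $x$ on no arc; $\mathrm{Supp}$ =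 set of points. Neighbor arc of $a$: $\Gamma_a=\{p\to q\in\mathcal A:p<a<q\}$; if empty, none; else with $X\in\{\overline{L_c},\overline{R_c}\}$ containing $a$, $S^X_a=\{p\to q\in\Gamma_a:p\in X\}$ ordered by initial points, $\alpha_a=\max S^X_a$ if nonempty, else $\min\Gamma_a$. $\mathcal C_a(\mathcal A)$: start empty, $b=a$; with $\gamma=\cdots\to b_0=b\to b_1\to\cdots$ the chain or loop containing $b$, append $b_0,\to,b_1,\to,\dots$; stop if infinitely many terms were added or $\max(\gamma)$ has no neighbor arc; else append $\downarrow$ if $\max(\gamma)\in\overline{L_c}$, $\uparrow$ otherwise, set $b$ to the final point of $\alpha_{\max(\gamma)}$, iterate. $\mathcal C^n_a(\mathcal A)$ replaces integers by residues mod $n$. If one (equivalently every) $\mathcal C_a(\mathcal A)$ is infinite, all $\mathcal C^n_a(\mathcal A)$ are ultimately periodic with a common period; $\mathcal C^n(\mathcal A)$ denotes any such periodic tail, and a periodic factor is a minimal-length word whose infinite repetition gives it. -}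

module Defs where

open import Data.Nat as ℕ using (ℕ; zero; suc)
open import Data.Integer as ℤ using (ℤ; +_; _<_; _≤_; _%ℕ_; 1ℤ)
open import Data.Bool using (Bool; true; false; if_then_else_)
open import Data.Fin using (Fin; toℕ)
open import Data.List using (List; []; _∷_; foldr; length; lookup)
open import Data.Product using (Σ; ∃; _×_; _,_)
open import Data.Sum using (_⊎_)
open import Data.Empty using (⊥)
open import Relation.Nullary using (¬_)
open import Relation.Binary.PropositionalEquality using (_≡_; _≢_)
open import Relation.Nullary.Decidable using (⌊_⌋)
open import Function using (_∘_; id)

-- Residues mod n (n = 0 never used: the theorem assumes n ≥ 2)

_mod′_ : ℤ → ℕ → ℕ
x mod′ zero  = 0
x mod′ suc m = x %ℕ suc m

-- s i exchanges i + mn and i + 1 + mn for all m (i ∈ {0,…,n-1})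
sgen : (n : ℕ) → Fin n → ℤ → ℤ
sgen n i x =
  if ⌊ (x mod′ n) ℕ.≟ toℕ i ⌋ then x ℤ.+ 1ℤ
  else if ⌊ (x mod′ n) ℕ.≟ ((suc (toℕ i)) ℕ.% n′) ⌋ then x ℤ.- 1ℤ
  else x
  where
  n′ : ℕ
  n′ = suc (ℕ.pred n)

coxProd : (n : ℕ) → List (Fin n) → ℤ → ℤ
coxProd n = foldr (λ i f → sgen n i ∘ f) id

-- An arc (p , q , L , R) with L ⊔ R = {p+1,…,q-1} is encoded by
-- p, q and a Boolean colouring inL of the integers: L = {x ∈ (p,q) : inL x}
-- and R = {x ∈ (p,q) : ¬ inL x}; values of inL outside (p,q) are irrelevant.

record Arc : Set where
  constructor mkArc
  field
    p    : ℤ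
    q    : ℤ
    inL  : ℤ → Bool
open Arc public

IsArc : ℕ → Arc → Set
IsArc n α = (p α < q α) × ((p α mod′ n) ≢ (q α mod′ n))

InL : Arc → ℤ → Set
InL α x = (p α < x) × (x < q α) × (inL α x ≡ true)

InR : Arc → ℤ → Set
InR α x = (p α < x) × (x < q α) × (inL α x ≡ false)

ArcEq : Arc → Arc → Set
ArcEq α β = (p α ≡ p β) × (q α ≡ q β) × (∀ x → p α < x → x < q α → inL α x ≡ inL β x)

shift : ℤ → Arc → Arc
shift k α = mkArc (p α ℤ.+ k) (q α ℤ.+ k) (λ x → inL α (x ℤ.- k))

-- crossing of (p,q,L,R) and (p',q',L',R'):
-- ((L ∪ {p,q}) ∩ R') ∪ (L ∩ {p',q'}) ≠ ∅  and
-- (R ∩ (L' ∪ {p',q'})) ∪ ({p,q} ∩ L') ≠ ∅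
IsEnd : Arc → ℤ → Set
IsEnd α x = (x ≡ p α) ⊎ (x ≡ q α)

Cross : Arc → Arc → Set
Cross α β =
  (∃ λ x → ((InL α x ⊎ IsEnd α x) × InR β x) ⊎ (InL α x × IsEnd β x)) ×
  (∃ λ x → (InR α x × (InL β x ⊎ IsEnd β x)) ⊎ (IsEnd α x × InL β x))

data Sym (P : Set) : Set where
  pt    : P → Sym P
  right : Sym P
  down  : Sym P
  up    : Sym P

mapSym : {P Q : Set} → (P → Q) → Sym P → Sym Q
mapSym f (pt x) = pt (f x)
mapSym f right  = right
mapSym f down   = down
mapSym f up     = up

-- Diagrams (a set of arcs is a predicate 𝒜 on arcs, up to ArcEq)

module _ (n : ℕ) (c : ℤ → ℤ) (𝒜 : Arc → Set) where

  -- x ∈ L̄_c  iff  c x > x ;  x ∈ R̄_c iff c x < x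
  -- there is an arc x → y in 𝒜
  Next : ℤ → ℤ → Set
  Next x y = ∃ λ α → 𝒜 α × (p α ≡ x) × (q α ≡ y)

  NoSucc : ℤ → Set
  NoSucc x = ∀ y → ¬ Next x y

  NoPred : ℤ → Set
  NoPred y = ∀ x → ¬ Next x y

  OnNoArc : ℤ → Set
  OnNoArc x = ∀ α → 𝒜 α → (p α ≢ x) × (q α ≢ x)

  data ChainOrLoop : Set where
    fullChain : (m : ℕ) (x : ℕ → ℤ) → 1 ℕ.≤ m →
                (∀ i → i ℕ.< m → Next (x i) (x (suc i))) →
                NoPred (x 0) → NoSucc (x m) → ChainOrLoop
    singleton : (x : ℤ) → OnNoArc x → ChainOrLoop
    loop      : (x : ℤ → ℤ) → (∀ i → Next (x i) (x (i ℤ.+ 1ℤ))) → ChainOrLoop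

  Supp : ChainOrLoop → ℤ → Set
  Supp (fullChain m x _ _ _ _) y = ∃ λ i → (i ℕ.≤ m) × (x i ≡ y)
  Supp (singleton x _)         y = x ≡ y
  Supp (loop x _)              y = ∃ λ i → x i ≡ y

  RealLoop : (ℤ → ℤ) → Set
  RealLoop x = (∃ λ i → x i < c (x i)) × (∃ λ j → c (x j) < x j)

  record CyclicDiagram : Set where
    field
      wf        : ∀ α → 𝒜 α → IsArc n α
      respects  : ∀ α β → 𝒜 α → ArcEq α β → 𝒜 β
      transl⁺   : ∀ α → 𝒜 α → 𝒜 (shift (+ n) α)
      transl⁻   : ∀ α → 𝒜 α → 𝒜 (shift (ℤ.- (+ n)) α)
      noncross  : ∀ α β → 𝒜 α → 𝒜 β → ¬ ArcEq α β → ¬ Cross α β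
      initUniq  : ∀ α β → 𝒜 α → 𝒜 β → p α ≡ p β → ArcEq α β
      finUniq   : ∀ α β → 𝒜 α → 𝒜 β → q α ≡ q β → ArcEq α β
      Lside     : ∀ α → 𝒜 α → ∀ x → InL α x → x < c x
      Rside     : ∀ α → 𝒜 α → ∀ x → InR α x → c x < x
      loopsReal : ∀ (x : ℤ → ℤ) → (∀ i → Next (x i) (x (i ℤ.+ 1ℤ))) → RealLoop x

  SameSide : ℤ → ℤ → Set
  SameSide a x = ((a < c a) × (x < c x)) ⊎ ((c a < a) × (c x < x))

  -- α is the neighbor arc α_a of a (Γ_a nonempty, α = max S^X_a if S^X_a ≠ ∅,
  -- else min Γ_a, arcs ordered by initial points)
  InΓ : ℤ → Arc → Set
  InΓ a β = 𝒜 β × (p β < a) × (a < q β)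

  NeighborArc : ℤ → Arc → Set
  NeighborArc a α = InΓ a α ×
    ( (SameSide a (p α) × (∀ β → InΓ a β → SameSide a (p β) → p β ≤ p α))
    ⊎ ((∀ β → InΓ a β → ¬ SameSide a (p β)) × (∀ β → InΓ a β → p α ≤ p β)) )

  -- the arrow appended after max(γ) = e
  ArrowFor : ℤ → Sym ℤ → Set
  ArrowFor e σ = ((e < c e) × (σ ≡ down)) ⊎ (¬ (e < c e) × (σ ≡ up))

  -- s is the (infinite) sequence 𝒞_a(𝒜): the construction never stops and
  -- produces exactly s.
  InfiniteC : ℤ → (ℕ → Sym ℤ) → Set
  InfiniteC a s = (s 0 ≡ pt a) × (∀ i x → s i ≡ pt x →
      (∃ λ y → Next x y × (s (suc i) ≡ right) × (s (suc (suc i)) ≡ pt y))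
    ⊎ (NoSucc x × ∃ λ α → NeighborArc x α × ArrowFor x (s (suc i)) ×
                          (s (suc (suc i)) ≡ pt (q α))))

module _ {S : Set} where
  Repeats : (ℕ → S) → List S → Set
  Repeats t τ = (τ ≢ []) ×
    (∀ m (j : Fin (length τ)) → t (m ℕ.* length τ ℕ.+ toℕ j) ≡ lookup τ j)

  PeriodicFactor : (ℕ → S) → List S → Set
  PeriodicFactor t τ = Repeats t τ × (∀ τ′ → length τ′ ℕ.< length τ → ¬ Repeats t τ′)

-- A chain or loop γ meeting both L̄_c and R̄_c contains an arc u → v of 𝒜 whose
-- endpoints lie on opposite sides. As 𝒜 and c commute with translation by n, a
-- translate δ of this arc lies beyond any given point of 𝒞_a(𝒜), and q δ ≡ v (mod n).
-- The points of 𝒞_a(𝒜) increase, each being the final point of an arc that starts at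
-- or before the previous point (the next arc of its chain, or its neighbor arc).
-- Noncrossing forces every point of 𝒞_a(𝒜) strictly inside δ onto the side of q δ,
-- and then forbids a step from inside δ to beyond q δ. So 𝒞_a(𝒜) passes through q δ
-- inside its periodic tail, and the residue of v occurs in τ.

module Submission where

open import Defs
import Data.Integer.Properties as ℤP
open import Algebra.Properties.CommutativeSemigroup ℤP.+-commutativeSemigroup
  using (xy∙z≈xz∙y; xy∙z≈x∙zy; x∙yz≈yx∙z)
open import Data.Bool using (Bool; true; false; not)
open import Data.Empty using (⊥-elim)
open import Data.Fin using (Fin; toℕ)
open import Data.Integer as ℤ using (ℤ; +_; -[1+_]; _⊖_; _%ℕ_; 1ℤ; _<_; _≤_; +<+; -≤+)
open import Data.Integer.Tactic.RingSolver using (solve-∀)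
open import Data.List using (List; []; _∷_; allFin; length; lookup)
open import Data.List.Membership.Propositional using (_∈_)
open import Data.List.Membership.Propositional.Properties using (∈-lookup)
open import Data.List.Relation.Binary.Permutation.Propositional using (_↭_)
open import Data.Nat as ℕ using (ℕ; zero; suc; NonZero; _+_; _∸_; z≤n; s≤s)
import Data.Nat.Properties as ℕP
open import Data.Nat.DivMod
  using (_%_; _divMod_; result; m%n<n; [m+n]%n≡m%n; n%n≡0; m<n⇒m%n≡m; m≤n⇒[n∸m]%m≡n%m)
open import Data.Product using (Σ; ∃; _×_; _,_; proj₁; proj₂)
open import Data.Sum using (_⊎_; inj₁; inj₂; swap)
open import Function using (_∘_)
open import Relation.Binary using (tri<; tri≈; tri>)
open import Relation.Binary.PropositionalEquality
open import Relation.Nullary using (¬_; yes; no)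
open import Relation.Nullary.Decidable using (⌊_⌋)

-[1+m]%ℕd≡[d∸[1+m]%d]%d : ∀ m d .{{_ : NonZero d}} → -[1+ m ] %ℕ d ≡ (d ∸ suc m % d) % d
-[1+m]%ℕd≡[d∸[1+m]%d]%d m d with suc m % d | m%n<n (suc m) d
... | zero  | _   = sym (n%n≡0 d)
... | suc r | r<d = sym (m<n⇒m%n≡m (ℕP.∸-monoʳ-< {o = 0} ℕ.z<s (ℕP.<⇒≤ r<d)))

-[1+]%ℕ-cong : ∀ {m m′} d .{{_ : NonZero d}} → suc m % d ≡ suc m′ % d → -[1+ m ] %ℕ d ≡ -[1+ m′ ] %ℕ d
-[1+]%ℕ-cong {m} {m′} d eq = begin
  -[1+ m ] %ℕ d        ≡⟨ -[1+m]%ℕd≡[d∸[1+m]%d]%d m d ⟩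
  (d ∸ suc m % d) % d  ≡⟨ cong (λ r → (d ∸ r) % d) eq ⟩
  (d ∸ suc m′ % d) % d ≡⟨ -[1+m]%ℕd≡[d∸[1+m]%d]%d m′ d ⟨
  -[1+ m′ ] %ℕ d       ∎
  where open ≡-Reasoning

%ℕ-periodic : ∀ x d .{{_ : NonZero d}} → (x ℤ.+ + d) %ℕ d ≡ x %ℕ d
%ℕ-periodic (+ m)    d = [m+n]%n≡m%n m d
%ℕ-periodic -[1+ m ] d with ℕP.<-cmp (suc m) d
... | tri< 1+m<d _ _ = begin
  (d ⊖ suc m) %ℕ d    ≡⟨ cong (_%ℕ d) (ℤP.⊖-≥ (ℕP.<⇒≤ 1+m<d)) ⟩
  (d ∸ suc m) % d     ≡⟨ cong (λ r → (d ∸ r) % d) (m<n⇒m%n≡m 1+m<d) ⟨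
  (d ∸ suc m % d) % d ≡⟨ -[1+m]%ℕd≡[d∸[1+m]%d]%d m d ⟨
  -[1+ m ] %ℕ d       ∎
  where open ≡-Reasoning
... | tri≈ _ refl _ = begin
  (suc m ⊖ suc m) %ℕ suc m            ≡⟨ cong (_%ℕ suc m) (ℤP.n⊖n≡0 (suc m)) ⟩
  0                                   ≡⟨ n%n≡0 (suc m) ⟨
  (suc m ∸ 0) % suc m                 ≡⟨ cong (λ r → (suc m ∸ r) % suc m) (n%n≡0 (suc m)) ⟨
  (suc m ∸ suc m % suc m) % suc m     ≡⟨ -[1+m]%ℕd≡[d∸[1+m]%d]%d m (suc m) ⟨
  -[1+ m ] %ℕ suc m                   ∎
  where open ≡-Reasoning
... | tri> _ _ d<1+m = begin
  (d ⊖ suc m) %ℕ d     ≡⟨ cong (_%ℕ d) (ℤP.⊖-< d<1+m) ⟩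
  ℤ.- + (suc m ∸ d) %ℕ d ≡⟨ cong (λ k → ℤ.- + k %ℕ d) (ℕP.+-∸-assoc 1 d≤m) ⟩
  -[1+ m ∸ d ] %ℕ d    ≡⟨ -[1+]%ℕ-cong d [1+m∸d]%d≡[1+m]%d ⟩
  -[1+ m ] %ℕ d        ∎
  where
  open ≡-Reasoning
  d≤m : d ℕ.≤ m
  d≤m = ℕP.≤-pred d<1+m
  [1+m∸d]%d≡[1+m]%d : suc (m ∸ d) % d ≡ suc m % d
  [1+m∸d]%d≡[1+m]%d = trans (cong (_% d) (sym (ℕP.+-∸-assoc 1 d≤m))) (m≤n⇒[n∸m]%m≡n%m (ℕP.<⇒≤ d<1+m))

mod′-periodic : ∀ n x → (x ℤ.+ + n) mod′ n ≡ x mod′ n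
mod′-periodic zero    x = refl
mod′-periodic (suc m) x = %ℕ-periodic x (suc m)

sgen-periodic : ∀ n i x → sgen n i (x ℤ.+ + n) ≡ sgen n i x ℤ.+ + n
sgen-periodic n i x rewrite mod′-periodic n x
  with ⌊ x mod′ n ℕ.≟ toℕ i ⌋ | ⌊ x mod′ n ℕ.≟ suc (toℕ i) ℕ.% suc (ℕ.pred n) ⌋
... | true  | _     = xy∙z≈xz∙y x (+ n) 1ℤ
... | false | true  = xy∙z≈xz∙y x (+ n) (ℤ.- 1ℤ)
... | false | false = refl

coxProd-periodic : ∀ n w x → coxProd n w (x ℤ.+ + n) ≡ coxProd n w x ℤ.+ + n
coxProd-periodic n []      x = refl
coxProd-periodic n (i ∷ w) x =
  trans (cong (sgen n i) (coxProd-periodic n w x)) (sgen-periodic n i (coxProd n w x))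

Repeats⇒∈ : ∀ {S : Set} {t : ℕ → S} {τ} → Repeats t τ → ∀ d → t d ∈ τ
Repeats⇒∈ {τ = []} (τ≢[] , _) d = ⊥-elim (τ≢[] refl)
Repeats⇒∈ {t = t} {τ = τ@(_ ∷ _)} (_ , t≡τ) d with d divMod length τ
... | result m j d≡j+m*L = subst (_∈ τ) (sym t[d]≡τ[j]) (∈-lookup j)
  where
  t[d]≡τ[j] : t d ≡ lookup τ j
  t[d]≡τ[j] = trans (cong t (trans d≡j+m*L (ℕP.+-comm (toℕ j) _))) (t≡τ m j)

Repeats-from⇒∈ : ∀ {S : Set} {t : ℕ → S} {τ} N → Repeats (λ i → t (N + i)) τ →
                 ∀ {i} → N ℕ.≤ i → t i ∈ τ
Repeats-from⇒∈ {t = t} {τ} N rep {i} N≤i =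
  subst (λ k → t k ∈ τ) (ℕP.m+[n∸m]≡n N≤i) (Repeats⇒∈ {t = λ k → t (N + k)} rep (i ∸ N))

j+[i-j]≡i : ∀ i j → j ℤ.+ (i ℤ.- j) ≡ i
j+[i-j]≡i = solve-∀

i≤+∣i∣ : ∀ i → i ≤ + ℤ.∣ i ∣
i≤+∣i∣ (+ _)    = ℤP.≤-refl
i≤+∣i∣ -[1+ _ ] = -≤+

increasing⇒unbounded : (f : ℕ → ℤ) → (∀ k → f k < f (suc k)) → ∀ y → ∃ λ k → y < f k
increasing⇒unbounded f f↑ y = go (suc ℤ.∣ y ℤ.- f 0 ∣) 0 y<f0+d
  where
  open ℤP.≤-Reasoning
  y<f0+d : y < f 0 ℤ.+ + suc ℤ.∣ y ℤ.- f 0 ∣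
  y<f0+d = begin-strict
    y                                    ≡⟨ j+[i-j]≡i y (f 0) ⟨
    f 0 ℤ.+ (y ℤ.- f 0)                  ≤⟨ ℤP.+-monoʳ-≤ (f 0) (i≤+∣i∣ (y ℤ.- f 0)) ⟩
    f 0 ℤ.+ + ℤ.∣ y ℤ.- f 0 ∣            <⟨ ℤP.+-monoʳ-< (f 0) (+<+ (ℕP.n<1+n _)) ⟩
    f 0 ℤ.+ + suc ℤ.∣ y ℤ.- f 0 ∣        ∎
  go : ∀ d k → y < f k ℤ.+ + d → ∃ λ k → y < f k
  go zero    k y<fk+0 = k , subst (y <_) (ℤP.+-identityʳ (f k)) y<fk+0
  go (suc d) k y<fk+d+1 = go d (suc k) (begin-strict
    y                         <⟨ y<fk+d+1 ⟩
    f k ℤ.+ (1ℤ ℤ.+ + d)      ≡⟨ x∙yz≈yx∙z (f k) 1ℤ (+ d) ⟩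
    ℤ.suc (f k) ℤ.+ + d       ≤⟨ ℤP.+-monoˡ-≤ (+ d) (ℤP.i<j⇒suc[i]≤j (f↑ k)) ⟩
    f (suc k) ℤ.+ + d         ∎)

first-crossing : (f : ℕ → ℤ) {y : ℤ} → f 0 < y → ∀ K → y ≤ f K → ∃ λ j → f j < y × y ≤ f (suc j)
first-crossing f f0<y zero    y≤f0 = ⊥-elim (ℤP.<⇒≱ f0<y y≤f0)
first-crossing f {y} f0<y (suc K) y≤fK+1 with f K ℤ.<? y
... | yes fK<y = K , fK<y , y≤fK+1
... | no  fK≮y = first-crossing f f0<y K (ℤP.≮⇒≥ fK≮y)

module Diagram (n : ℕ) (c : ℤ → ℤ) (𝒜 : Arc → Set) (D : CyclicDiagram n c 𝒜)
               (c-nofix : ∀ x → c x ≢ x) where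
  open CyclicDiagram D

  -- Side true is L̄_c and Side false is R̄_c.
  Side : Bool → ℤ → Set
  Side true  x = x < c x
  Side false x = c x < x

  L-or-R : ∀ x → Side true x ⊎ Side false x
  L-or-R x with ℤP.<-cmp x (c x)
  ... | tri< x<cx _ _ = inj₁ x<cx
  ... | tri≈ _ x≡cx _ = ⊥-elim (c-nofix x (sym x≡cx))
  ... | tri> _ _ cx<x = inj₂ cx<x

  side-either : ∀ b x → Side b x ⊎ Side (not b) x
  side-either true  x = L-or-R x
  side-either false x = swap (L-or-R x)

  sides-disjoint : ∀ b {x} → Side b x → ¬ Side (not b) x
  sides-disjoint true  x<cx cx<x = ℤP.<-asym x<cx cx<x
  sides-disjoint false cx<x x<cx = ℤP.<-asym cx<x x<cx

  sameSide⇒side : ∀ b {a x} → SameSide n c 𝒜 a x → Side b a → Side b x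
  sameSide⇒side true  (inj₁ (_ , x∈L)) _    = x∈L
  sameSide⇒side true  (inj₂ (a∈R , _)) a∈L = ⊥-elim (sides-disjoint true a∈L a∈R)
  sameSide⇒side false (inj₁ (a∈L , _)) a∈R = ⊥-elim (sides-disjoint false a∈R a∈L)
  sameSide⇒side false (inj₂ (_ , x∈R)) _    = x∈R

  Opposite : ℤ → ℤ → Set
  Opposite x y = Σ Bool λ b → Side b x × Side (not b) y

  OppositeArc : Arc → Set
  OppositeArc α = 𝒜 α × Opposite (p α) (q α)

  Interior : Arc → ℤ → Set
  Interior α x = p α < x × x < q α

  interior⇒InL : ∀ {α x} → 𝒜 α → Interior α x → Side true x → InL α x
  interior⇒InL {α} {x} α∈𝒜 (p<x , x<q) x∈L with inL α x in eq
  ... | true  = p<x , x<q , refl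
  ... | false = ⊥-elim (sides-disjoint true x∈L (Rside α α∈𝒜 x (p<x , x<q , eq)))

  interior⇒InR : ∀ {α x} → 𝒜 α → Interior α x → Side false x → InR α x
  interior⇒InR {α} {x} α∈𝒜 (p<x , x<q) x∈R with inL α x in eq
  ... | false = p<x , x<q , refl
  ... | true  = ⊥-elim (sides-disjoint false x∈R (Lside α α∈𝒜 x (p<x , x<q , eq)))

  interior-end⇒¬ArcEq : ∀ {α β x} → Interior α x → IsEnd β x → ¬ ArcEq α β
  interior-end⇒¬ArcEq (p<x , _) (inj₁ x≡pβ) (pα≡pβ , _)     = ℤP.<-irrefl (trans pα≡pβ (sym x≡pβ)) p<x
  interior-end⇒¬ArcEq (_ , x<q) (inj₂ x≡qβ) (_ , qα≡qβ , _) = ℤP.<-irrefl (trans x≡qβ (sym qα≡qβ)) x<q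

  nested-ends-same-side : ∀ b {α β x y} → 𝒜 α → 𝒜 β → IsEnd β x → IsEnd β y →
                          Interior α x → Interior α y → Side b x → Side b y
  nested-ends-same-side b {α} {β} {x} {y} α∈𝒜 β∈𝒜 x∈∂β y∈∂β x∈α y∈α x∈b with side-either b y
  ... | inj₁ y∈b  = y∈b
  ... | inj₂ y∈¬b = ⊥-elim (noncross α β α∈𝒜 β∈𝒜 (interior-end⇒¬ArcEq x∈α x∈∂β) (crossing b x∈b y∈¬b))
    where
    crossing : ∀ b → Side b x → Side (not b) y → Cross α β
    crossing true  x∈L y∈R = (x , inj₂ (interior⇒InL α∈𝒜 x∈α x∈L , x∈∂β))
                           , (y , inj₁ (interior⇒InR α∈𝒜 y∈α y∈R , inj₂ y∈∂β))
    crossing false x∈R y∈L = (y , inj₂ (interior⇒InL α∈𝒜 y∈α y∈L , y∈∂β))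
                           , (x , inj₁ (interior⇒InR α∈𝒜 x∈α x∈R , inj₂ x∈∂β))

  interleaved-ends-opposite : ∀ b {α β x y} → 𝒜 α → 𝒜 β → IsEnd α x → Interior β x →
                              IsEnd β y → Interior α y → Side b x → Side (not b) y
  interleaved-ends-opposite b {α} {β} {x} {y} α∈𝒜 β∈𝒜 x∈∂α x∈β y∈∂β y∈α x∈b with side-either b y
  ... | inj₂ y∈¬b = y∈¬b
  ... | inj₁ y∈b  = ⊥-elim (noncross α β α∈𝒜 β∈𝒜 (interior-end⇒¬ArcEq y∈α y∈∂β) (crossing b x∈b y∈b))
    where
    crossing : ∀ b → Side b x → Side b y → Cross α β
    crossing true  x∈L y∈L = (y , inj₂ (interior⇒InL α∈𝒜 y∈α y∈L , y∈∂β))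
                           , (x , inj₂ (x∈∂α , interior⇒InL β∈𝒜 x∈β x∈L))
    crossing false x∈R y∈R = (x , inj₁ (inj₂ x∈∂α , interior⇒InR β∈𝒜 x∈β x∈R))
                           , (y , inj₁ (interior⇒InR α∈𝒜 y∈α y∈R , inj₂ y∈∂β))

  side-change : (f : ℕ → ℤ) {i j : ℕ} (b : Bool) → i ℕ.≤ j → Side b (f i) → Side (not b) (f j) →
                ∃ λ k → k ℕ.< j × Opposite (f k) (f (suc k))
  side-change f {j = zero} b z≤n f0∈b f0∈¬b = ⊥-elim (sides-disjoint b f0∈b f0∈¬b)
  side-change f {i} {suc j} b i≤j+1 fi∈b fj+1∈¬b with side-either b (f j)
  ... | inj₁ fj∈b  = j , ℕP.n<1+n j , b , fj∈b , fj+1∈¬b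
  ... | inj₂ fj∈¬b with ℕP.m≤n⇒m<n∨m≡n i≤j+1
  ...   | inj₂ refl  = ⊥-elim (sides-disjoint b fi∈b fj+1∈¬b)
  ...   | inj₁ i<j+1 with side-change f b (ℕP.≤-pred i<j+1) fi∈b fj∈¬b
  ...     | k , k<j , opp = k , ℕP.m<n⇒m<1+n k<j , opp

  opposite-next : ∀ {u v} → Next n c 𝒜 u v → Opposite u v → ∃ λ α → OppositeArc α × q α ≡ v
  opposite-next (α , α∈𝒜 , refl , refl) opp = α , (α∈𝒜 , opp) , refl

  OppositeArcIn : ChainOrLoop n c 𝒜 → Set
  OppositeArcIn γ = ∃ λ α → OppositeArc α × Supp n c 𝒜 γ (q α)

  chain-opposite-arc : ∀ {m x i j} → (∀ k → k ℕ.< m → Next n c 𝒜 (x k) (x (suc k))) →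
                       ∀ b → i ℕ.≤ j → j ℕ.≤ m → Side b (x i) → Side (not b) (x j) →
                       ∃ λ α → OppositeArc α × ∃ λ k → k ℕ.≤ m × x k ≡ q α
  chain-opposite-arc {x = x} nx b i≤j j≤m xi∈b xj∈¬b with side-change x b i≤j xi∈b xj∈¬b
  ... | k , k<j , opp with opposite-next (nx k (ℕP.<-≤-trans k<j j≤m)) opp
  ... | α , α-opp , qα≡xk+1 = α , α-opp , suc k , ℕP.<-≤-trans k<j j≤m , sym qα≡xk+1

  loop-opposite-arc : ∀ {x i j} → (∀ k → Next n c 𝒜 (x k) (x (k ℤ.+ 1ℤ))) →
                      ∀ b → i ≤ j → Side b (x i) → Side (not b) (x j) →
                      ∃ λ α → OppositeArc α × ∃ λ k → x k ≡ q α
  loop-opposite-arc {x} {i} {j} nx b i≤j xi∈b xj∈¬b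
    with side-change (λ k → x (i ℤ.+ + k)) b z≤n
           (subst (Side b ∘ x) (sym (ℤP.+-identityʳ i)) xi∈b)
           (subst (Side (not b) ∘ x) i+∣i-j∣≡j xj∈¬b)
    where
    i+∣i-j∣≡j : j ≡ i ℤ.+ + ℤ.∣ i ℤ.- j ∣
    i+∣i-j∣≡j = trans (sym (j+[i-j]≡i j i)) (cong (ℤ._+_ i) (sym (ℤP.∣-∣-≤ i≤j)))
  ... | k , _ , opp
    with opposite-next (subst (Next n c 𝒜 (x (i ℤ.+ + k)) ∘ x) (xy∙z≈x∙zy i (+ k) 1ℤ) (nx (i ℤ.+ + k)))
                       opp
  ... | α , α-opp , qα≡x[i+k+1] = α , α-opp , i ℤ.+ + suc k , sym qα≡x[i+k+1]

  opposite-arc : (γ : ChainOrLoop n c 𝒜) → (∃ λ y → Supp n c 𝒜 γ y × Side true y) →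
                 (∃ λ y → Supp n c 𝒜 γ y × Side false y) → OppositeArcIn γ
  opposite-arc (fullChain m x _ nx _ _) (_ , (i , i≤m , refl) , xi∈L) (_ , (j , j≤m , refl) , xj∈R)
    with ℕP.≤-total i j
  ... | inj₁ i≤j = chain-opposite-arc nx true  i≤j j≤m xi∈L xj∈R
  ... | inj₂ j≤i = chain-opposite-arc nx false j≤i i≤m xj∈R xi∈L
  opposite-arc (singleton _ _) (_ , refl , x∈L) (_ , refl , x∈R) = ⊥-elim (sides-disjoint true x∈L x∈R)
  opposite-arc (loop x nx) (_ , (i , refl) , xi∈L) (_ , (j , refl) , xj∈R) with ℤP.≤-total i j
  ... | inj₁ i≤j = loop-opposite-arc nx true  i≤j xi∈L xj∈R
  ... | inj₂ j≤i = loop-opposite-arc nx false j≤i xj∈R xi∈L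

  record Step (z z′ : ℤ) : Set where
    constructor step
    field
      arc   : Arc
      arc∈𝒜 : 𝒜 arc
      end   : q arc ≡ z′
      start : p arc ≡ z ⊎ NeighborArc n c 𝒜 z arc
  open Step using (arc)

  step-start≤ : ∀ {z z′} (st : Step z z′) → p (arc st) ≤ z
  step-start≤ (step _ _ _ (inj₁ refl))                  = ℤP.≤-refl
  step-start≤ (step _ _ _ (inj₂ ((_ , pβ<z , _) , _))) = ℤP.<⇒≤ pβ<z

  step-increasing : ∀ {z z′} → Step z z′ → z < z′
  step-increasing (step β β∈𝒜 refl (inj₁ refl))         = proj₁ (wf β β∈𝒜)
  step-increasing (step _ _ refl (inj₂ ((_ , _ , z<qβ) , _))) = z<qβ

  step-start-side : ∀ b {δ z z′} → 𝒜 δ → (st : Step z z′) → p δ < p (arc st) → z < q δ →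
                    Side b z → Side b (p (arc st))
  step-start-side b δ∈𝒜 (step _ _ _ (inj₁ refl)) _ _ z∈b = z∈b
  step-start-side b δ∈𝒜 (step _ _ _ (inj₂ (_ , inj₁ (same-side , _)))) _ _ z∈b =
    sameSide⇒side b same-side z∈b
  step-start-side b {δ} δ∈𝒜 st@(step _ _ _ (inj₂ (_ , inj₂ (_ , leftmost)))) pδ<pβ z<qδ _ =
    ⊥-elim (ℤP.<⇒≱ pδ<pβ (leftmost δ (δ∈𝒜 , ℤP.<-≤-trans pδ<pβ (step-start≤ st) , z<qδ)))

  step-inside-keeps-side : ∀ b {δ z z′} → 𝒜 δ → Side b (p δ) → Step z z′ →
                           (p δ < z → Side (not b) z) → Interior δ z′ → Side (not b) z′
  step-inside-keeps-side b {δ} {z} δ∈𝒜 pδ∈b st@(step β β∈𝒜 refl _) z∈¬b z′∈δ@(pδ<z′ , z′<qδ)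
    with ℤP.<-cmp (p β) (p δ)
  ... | tri< pβ<pδ _ _ =
    interleaved-ends-opposite b δ∈𝒜 β∈𝒜 (inj₁ refl) (pβ<pδ , pδ<z′) (inj₂ refl) z′∈δ pδ∈b
  ... | tri≈ _ pβ≡pδ _ = ⊥-elim (ℤP.<-irrefl (proj₁ (proj₂ (initUniq β δ β∈𝒜 δ∈𝒜 pβ≡pδ))) z′<qδ)
  ... | tri> _ _ pδ<pβ =
    nested-ends-same-side (not b) δ∈𝒜 β∈𝒜 (inj₁ refl) (inj₂ refl) (pδ<pβ , pβ<qδ) z′∈δ pβ∈¬b
    where
    z<qδ : z < q δ
    z<qδ = ℤP.<-trans (step-increasing st) z′<qδ
    pβ<qδ : p β < q δ
    pβ<qδ = ℤP.≤-<-trans (step-start≤ st) z<qδ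
    pβ∈¬b : Side (not b) (p β)
    pβ∈¬b = step-start-side (not b) δ∈𝒜 st pδ<pβ z<qδ
              (z∈¬b (ℤP.<-≤-trans pδ<pβ (step-start≤ st)))

  step-cannot-pass-end : ∀ b {δ z z′} → 𝒜 δ → Side b (p δ) → Side (not b) (q δ) → Step z z′ →
                         (p δ < z → Side (not b) z) → z < q δ → ¬ (q δ < z′)
  step-cannot-pass-end b {δ} δ∈𝒜 pδ∈b qδ∈¬b st@(step β β∈𝒜 refl _) z∈¬b z<qδ qδ<qβ
    with ℤP.<-cmp (p β) (p δ)
  ... | tri< pβ<pδ _ _ =
    sides-disjoint b (nested-ends-same-side b β∈𝒜 δ∈𝒜 (inj₁ refl) (inj₂ refl)
                        (pβ<pδ , ℤP.<-trans pδ<qδ qδ<qβ) (ℤP.<-trans pβ<pδ pδ<qδ , qδ<qβ) pδ∈b)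
                     qδ∈¬b
    where
    pδ<qδ : p δ < q δ
    pδ<qδ = proj₁ (wf δ δ∈𝒜)
  ... | tri≈ _ pβ≡pδ _ = ℤP.<-irrefl (sym (proj₁ (proj₂ (initUniq β δ β∈𝒜 δ∈𝒜 pβ≡pδ)))) qδ<qβ
  ... | tri> _ _ pδ<pβ =
    sides-disjoint (not b) pβ∈¬b
      (interleaved-ends-opposite (not b) δ∈𝒜 β∈𝒜 (inj₂ refl) (pβ<qδ , qδ<qβ)
                                 (inj₁ refl) (pδ<pβ , pβ<qδ) qδ∈¬b)
    where
    pβ<qδ : p β < q δ
    pβ<qδ = ℤP.≤-<-trans (step-start≤ st) z<qδ
    pβ∈¬b : Side (not b) (p β)
    pβ∈¬b = step-start-side (not b) δ∈𝒜 st pδ<pβ z<qδ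
              (z∈¬b (ℤP.<-≤-trans pδ<pβ (step-start≤ st)))

  walk-reaches-end : (P : ℕ → ℤ) → (∀ k → Step (P k) (P (suc k))) →
                     ∀ {δ} → OppositeArc δ → P 0 < p δ → ∃ λ K → P K ≡ q δ
  walk-reaches-end P P-step {δ} (δ∈𝒜 , b , pδ∈b , qδ∈¬b) P0<pδ
    with increasing⇒unbounded P (step-increasing ∘ P-step) (q δ)
  ... | K , qδ<PK with first-crossing P (ℤP.<-trans P0<pδ (proj₁ (wf δ δ∈𝒜))) K (ℤP.<⇒≤ qδ<PK)
  ... | j , Pj<qδ , qδ≤Pj+1 = suc j , ℤP.≤-antisym (ℤP.≮⇒≥ no-pass) qδ≤Pj+1
    where
    on-end-side : ∀ k → p δ < P k → P k < q δ → Side (not b) (P k)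
    on-end-side zero    pδ<P0 _ = ⊥-elim (ℤP.<-asym pδ<P0 P0<pδ)
    on-end-side (suc k) pδ<Pk+1 Pk+1<qδ =
      step-inside-keeps-side b δ∈𝒜 pδ∈b (P-step k)
        (λ pδ<Pk → on-end-side k pδ<Pk (ℤP.<-trans (step-increasing (P-step k)) Pk+1<qδ))
        (pδ<Pk+1 , Pk+1<qδ)
    no-pass : ¬ (q δ < P (suc j))
    no-pass = step-cannot-pass-end b δ∈𝒜 pδ∈b qδ∈¬b (P-step j)
                (λ pδ<Pj → on-end-side j pδ<Pj Pj<qδ) Pj<qδ

  module Points {a : ℤ} {s : ℕ → Sym ℤ} (𝒞 : InfiniteC n c 𝒜 a s) where

    next-point : ∀ {i x} → s i ≡ pt x → Σ ℤ λ y → Step x y × s (2 + i) ≡ pt y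
    next-point {i} {x} sᵢ≡x with proj₂ 𝒞 i x sᵢ≡x
    ... | inj₁ (y , (α , α∈𝒜 , refl , refl) , _ , sᵢ₊₂≡y) =
      y , step α α∈𝒜 refl (inj₁ refl) , sᵢ₊₂≡y
    ... | inj₂ (_ , α , α-nbr , _ , sᵢ₊₂≡qα) =
      q α , step α (proj₁ (proj₁ α-nbr)) refl (inj₂ α-nbr) , sᵢ₊₂≡qα

    position : ℕ → ℕ
    position zero    = zero
    position (suc k) = 2 + position k

    point : ∀ k → Σ ℤ λ x → s (position k) ≡ pt x
    point zero    = a , proj₁ 𝒞
    point (suc k) = proj₁ next , proj₂ (proj₂ next)
      where
      next : Σ ℤ λ y → Step (proj₁ (point k)) y × s (position (suc k)) ≡ pt y
      next = next-point (proj₂ (point k))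

    walk : ℕ → ℤ
    walk k = proj₁ (point k)

    walk-position : ∀ k → s (position k) ≡ pt (walk k)
    walk-position k = proj₂ (point k)

    walk-step : ∀ k → Step (walk k) (walk (suc k))
    walk-step k = proj₁ (proj₂ (next-point (proj₂ (point k))))

    k≤position : ∀ k → k ℕ.≤ position k
    k≤position zero    = z≤n
    k≤position (suc k) = s≤s (ℕP.m≤n⇒m≤1+n (k≤position k))

    walk-residue-in-period : ∀ {N τ} → Repeats (λ i → mapSym (_mod′ n) (s (N + i))) τ →
                             ∀ K → pt (walk (K + N) mod′ n) ∈ τ
    walk-residue-in-period {N} {τ} τ-repeats K =
      subst (_∈ τ) (cong (mapSym (_mod′ n)) (walk-position (K + N)))
        (Repeats-from⇒∈ {t = mapSym (_mod′ n) ∘ s} N τ-repeats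
          (ℕP.≤-trans (ℕP.m≤n+m N K) (k≤position (K + N))))

  module _ (1≤n : 1 ℕ.≤ n) (c-periodic : ∀ x → c (x ℤ.+ + n) ≡ c x ℤ.+ + n) where

    side-periodic : ∀ b {x} → Side b x → Side b (x ℤ.+ + n)
    side-periodic true  {x} x<cx = subst (x ℤ.+ + n <_) (sym (c-periodic x)) (ℤP.+-monoˡ-< (+ n) x<cx)
    side-periodic false {x} cx<x = subst (_< x ℤ.+ + n) (sym (c-periodic x)) (ℤP.+-monoˡ-< (+ n) cx<x)

    translate : ℕ → Arc → Arc
    translate zero    α = α
    translate (suc m) α = shift (+ n) (translate m α)

    translate-opposite : ∀ m {α} → OppositeArc α → OppositeArc (translate m α)
    translate-opposite zero    α-opp = α-opp
    translate-opposite (suc m) α-opp with translate-opposite m α-opp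
    ... | β∈𝒜 , b , pβ∈b , qβ∈¬b =
      transl⁺ _ β∈𝒜 , b , side-periodic b pβ∈b , side-periodic (not b) qβ∈¬b

    translate-residue : ∀ m α → q (translate m α) mod′ n ≡ q α mod′ n
    translate-residue zero    α = refl
    translate-residue (suc m) α = trans (mod′-periodic n (q (translate m α))) (translate-residue m α)

    translate-increasing : ∀ α m → p (translate m α) < p (translate (suc m) α)
    translate-increasing α m =
      subst (_< p (translate (suc m) α)) (ℤP.+-identityʳ (p (translate m α)))
        (ℤP.+-monoʳ-< (p (translate m α)) (+<+ 1≤n))

    opposite-arc-beyond : ∀ B {α} → OppositeArc α →
                          ∃ λ β → OppositeArc β × q β mod′ n ≡ q α mod′ n × B < p β
    opposite-arc-beyond B {α} α-opp
      with increasing⇒unbounded (λ m → p (translate m α)) (translate-increasing α) B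
    ... | m , B<pₘ = translate m α , translate-opposite m α-opp , translate-residue m α , B<pₘ

    residue-in-period : ∀ {a s N τ} → InfiniteC n c 𝒜 a s →
                        Repeats (λ i → mapSym (_mod′ n) (s (N + i))) τ →
                        (γ : ChainOrLoop n c 𝒜) →
                        (∃ λ y → Supp n c 𝒜 γ y × Side true y) →
                        (∃ λ y → Supp n c 𝒜 γ y × Side false y) →
                        ∃ λ y → Supp n c 𝒜 γ y × pt (y mod′ n) ∈ τ
    residue-in-period {N = N} {τ} 𝒞 τ-repeats γ γ∩L γ∩R =
      let open Points 𝒞
          α , α-opp , qα∈γ = opposite-arc γ γ∩L γ∩R
          β , β-opp , qβ≡qα , walkN<pβ = opposite-arc-beyond (walk N) α-opp
          K , walk≡qβ = walk-reaches-end (λ k → walk (k + N)) (λ k → walk-step (k + N)) β-opp walkN<pβ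
      in q α , qα∈γ , subst (λ r → pt r ∈ τ) (trans (cong (_mod′ n) walk≡qβ) qβ≡qα)
                        (walk-residue-in-period τ-repeats K)

lemma3p29 : (n : ℕ) → 2 ℕ.≤ n → (w : List (Fin n)) → w ↭ allFin n →
    (∀ x → coxProd n w x ≢ x) →
    (𝒜 : Arc → Set) → CyclicDiagram n (coxProd n w) 𝒜 →
    (a : ℤ) (s : ℕ → Sym ℤ) → InfiniteC n (coxProd n w) 𝒜 a s →
    (N : ℕ) (τ : List (Sym ℕ)) →
    PeriodicFactor (λ i → mapSym (λ x → x mod′ n) (s (N + i))) τ →
    (γ : ChainOrLoop n (coxProd n w) 𝒜) →
    (∃ λ y → Supp n (coxProd n w) 𝒜 γ y × (y < coxProd n w y)) →
    (∃ λ y → Supp n (coxProd n w) 𝒜 γ y × (coxProd n w y < y)) →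
    ∃ λ y → Supp n (coxProd n w) 𝒜 γ y × (pt (y mod′ n) ∈ τ)
lemma3p29 n 2≤n w _ c-nofix 𝒜 D _ _ 𝒞 N _ (τ-repeats , _) =
  Diagram.residue-in-period n (coxProd n w) 𝒜 D c-nofix (ℕP.<⇒≤ 2≤n) (coxProd-periodic n w)
    {N = N} 𝒞 τ-repeats
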